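{- Let $G$ be a graph with ${\rm diam}(G)=3$ and let $\mathcal{I}$ be the set of all maximal independent sets of $G$. Then $\chi_{\rho}(G)=|V(G)|-m'(G)+2$, where $$m'(G)=\max_{A\in\mathcal{I}}\{|A|+\omega(D(G)-A)\}.$$
   Context: Graphs are finite and simple; $d(u,v)$ is the distance in $G$. A packing $k$-coloring is a map $c:V(G)\to\{1,\dots,k\}$ such that $c(u)=c(v)=i$, $u\ne v$, implies $d(u,v)>i$; the packing chromatic number $\chi_{\rho}(G)$ is the smallest $k$ for which a packing $k$-coloring exists. The diametrical graph $D(G)$ has vertex set $V(G)$, with $x,y$ adjacent iff $d(x,y)={\rm diam}(G)$; $D(G)-A$ is obtained by deleting the vertices of $A$. $\omega(H)$ is the clique number (maximum size of a clique) of $H$. -}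

module Defs where

open import Data.Nat using (ℕ; zero; suc; _≤_; _<_; _+_)
open import Data.Fin using (Fin; toℕ)
open import Data.Fin.Subset using (Subset; _∈_; _∉_; _⊆_; ∣_∣)
open import Data.Product using (Σ; ∃; _×_; _,_)
open import Relation.Nullary using (¬_)
open import Relation.Binary.PropositionalEquality using (_≡_; _≢_)

record Graph (n : ℕ) : Set₁ where
  field
    Adj    : Fin n → Fin n → Set
    sym    : ∀ {u v} → Adj u v → Adj v u
    irrefl : ∀ {u} → ¬ Adj u u
open Graph public

data Walk {n : ℕ} (G : Graph n) : Fin n → Fin n → ℕ → Set where
  nil  : ∀ {u} → Walk G u u zero
  cons : ∀ {u w v k} → Adj G u w → Walk G w v k → Walk G u v (suc k)

Dist : {n : ℕ} → Graph n → Fin n → Fin n → ℕ → Set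
Dist G u v k = Walk G u v k × (∀ j → j < k → ¬ Walk G u v j)

Diam : {n : ℕ} → Graph n → ℕ → Set
Diam G δ = (∀ u v → Σ ℕ λ k → Dist G u v k × k ≤ δ)
         × Σ _ λ u → Σ _ λ v → Dist G u v δ

-- Packing k-coloring: c assigns to each vertex a color in {1,…,k};
-- vertex u gets color suc (toℕ (c u)). Two distinct vertices with the same
-- color i must be at distance > i (vacuous if no path joins them).
IsPackingColoring : {n : ℕ} → Graph n → (k : ℕ) → (Fin n → Fin k) → Set
IsPackingColoring G k c =
  ∀ u v → u ≢ v → c u ≡ c v → ∀ d → Dist G u v d → suc (toℕ (c u)) < d

PackingColorable : {n : ℕ} → Graph n → ℕ → Set
PackingColorable {n} G k = Σ (Fin n → Fin k) λ c → IsPackingColoring G k c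

IsPackingChromaticNumber : {n : ℕ} → Graph n → ℕ → Set
IsPackingChromaticNumber G χ =
  PackingColorable G χ × (∀ k → PackingColorable G k → χ ≤ k)

Independent : {n : ℕ} → Graph n → Subset n → Set
Independent G A = ∀ u v → u ∈ A → v ∈ A → ¬ Adj G u v

MaximalIndependent : {n : ℕ} → Graph n → Subset n → Set
MaximalIndependent G A =
  Independent G A × (∀ B → A ⊆ B → Independent G B → A ≡ B)

-- Diametrical graph D(G) for a graph with diam(G) = δ:
-- x,y adjacent iff d(x,y) = δ.
DAdj : {n : ℕ} → Graph n → ℕ → Fin n → Fin n → Set
DAdj G δ x y = Dist G x y δ

IsCliqueDminus : {n : ℕ} → Graph n → ℕ → Subset n → Subset n → Set
IsCliqueDminus G δ A K =
  (∀ v → v ∈ K → v ∉ A) × (∀ u v → u ∈ K → v ∈ K → u ≢ v → DAdj G δ u v)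

IsCliqueNumberDminus : {n : ℕ} → Graph n → ℕ → Subset n → ℕ → Set
IsCliqueNumberDminus G δ A w =
  (Σ _ λ K → IsCliqueDminus G δ A K × ∣ K ∣ ≡ w)
  × (∀ K → IsCliqueDminus G δ A K → ∣ K ∣ ≤ w)

IsMPrime : {n : ℕ} → Graph n → ℕ → ℕ → Set
IsMPrime G δ m =
  (Σ _ λ A → MaximalIndependent G A × Σ ℕ λ w →
      IsCliqueNumberDminus G δ A w × ∣ A ∣ + w ≡ m)
  × (∀ A → MaximalIndependent G A → ∀ w →
      IsCliqueNumberDminus G δ A w → ∣ A ∣ + w ≤ m)

{-# OPTIONS --safe #-}

-- In a graph of diameter 3, two distinct vertices with the same colour i ≥ 3 would have to be
-- at distance greater than 3, so every colour beyond 2 is used at most once. The classes of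
-- colours 1 and 2 form a pair (I , K) with I independent and K a clique of D(G) − I, and
-- conversely every such pair extends to a packing colouring with n − |I| − |K| + 2 colours;
-- hence χ_ρ(G) = n + 2 − m for m the largest |I| + |K|. Finally m = m'(G), because enlarging
-- I to a maximal independent set A and replacing K by K ∖ A does not decrease |I| + |K|.

module Submission where

open import Defs
open import Data.Nat using (ℕ; _+_)
open import Data.Product using (Σ; _×_)
open import Relation.Binary.PropositionalEquality using (_≡_)

open import Data.Empty using (⊥-elim)
open import Data.Fin using (Fin; zero; suc; toℕ)
open import Data.Fin.Properties using (suc-injective; 0≢1+n; all?) renaming (_≟_ to _≟ᶠ_)
open import Data.Fin.Subset using (Subset; _∈_; _∉_; _⊆_; ∣_∣; _∪_; _∩_; ∁; _-_; ⊤; ⊥; inside; outside)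
open import Data.Fin.Subset.Properties using (_∈?_; _⊆?_; ⊆-refl; ∈⊤; ∉⊥; ∣⊤∣≡n; ∣p∣≤n; ∣∁p∣≡n∸∣p∣; drop-∷-⊆; p⊆q⇒∣p∣≤∣q∣; x∈p⇒∣p-x∣<∣p∣; x∈p∧x≢y⇒x∈p-y; x∈∁p⇒x∉p; x∉p⇒x∈∁p; x∈p∩q⁻; x∈p∪q⁻; x∈p∪q⁺)
open import Data.List using (List; []; _∷_; [_]; map; _++_; filter; cartesianProduct)
open import Data.List.Extrema.Nat using (argmax; argmax-all; f[xs]≤f[argmax])
open import Data.List.Membership.Propositional using () renaming (_∈_ to _∈ₗ_)
open import Data.List.Membership.Propositional.Properties using (∈-map⁺; ∈-++⁺ˡ; ∈-++⁺ʳ; ∈-filter⁺; ∈-cartesianProduct⁺)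
open import Data.List.Relation.Unary.All using (lookup)
open import Data.List.Relation.Unary.All.Properties using (all-filter)
open import Data.List.Relation.Unary.Any using (here)
open import Data.Nat using (_≟_; zero; suc; _≤_; _<_; z≤n; s≤s)
open import Data.Nat.Properties using (≤-refl; ≤-trans; ≤-antisym; ≤⇒≯; 1+n≰n; <-cmp; +-comm; +-assoc; +-suc; +-monoˡ-≤; +-monoʳ-≤; m+[n∸m]≡n; ∸-monoʳ-≤; module ≤-Reasoning)
open import Data.Product using (∃; _,_; proj₁; proj₂)
open import Data.Sum using (inj₁; inj₂; [_,_]′)
open import Data.Vec using ([]; _∷_; here; there; tabulate)
open import Data.Vec.Properties using ([]=⇒lookup; lookup⇒[]=; lookup∘tabulate)
open import Function using (_∘_)
open import Relation.Nullary using (¬_; Dec; yes; no; does; ¬?)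
open import Relation.Nullary.Decidable using (dec-true; _×-dec_; _→-dec_)
open import Relation.Unary using (Decidable)
open import Relation.Binary.Definitions using (tri<; tri≈; tri>)
open import Relation.Binary.PropositionalEquality using (refl; trans; cong; subst; subst₂; _≢_)
import Relation.Binary.PropositionalEquality as ≡

private
  variable
    n k : ℕ

IsMaximum : {A : Set} → (A → Set) → (A → ℕ) → A → Set
IsMaximum P f x = P x × (∀ y → P y → f y ≤ f x)

maximum-exists : {A : Set} {P : A → Set} → Decidable P → (f : A → ℕ) →
  {xs : List A} → (∀ x → x ∈ₗ xs) → ∀ {a} → P a → ∃ (IsMaximum P f)
maximum-exists P? f {xs} enum {a} pa =
  argmax f a (filter P? xs) ,
  argmax-all f pa (all-filter P? xs) ,
  λ y py → lookup (f[xs]≤f[argmax] a (filter P? xs)) (∈-filter⁺ P? (enum y) py)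

subsets : ∀ n → List (Subset n)
subsets zero    = [ [] ]
subsets (suc n) = map (inside ∷_) (subsets n) ++ map (outside ∷_) (subsets n)

∈-subsets : (p : Subset n) → p ∈ₗ subsets n
∈-subsets []                    = here refl
∈-subsets (inside ∷ p)          = ∈-++⁺ˡ (∈-map⁺ (inside ∷_) (∈-subsets p))
∈-subsets {suc n} (outside ∷ p) = ∈-++⁺ʳ (map (inside ∷_) (subsets n)) (∈-map⁺ (outside ∷_) (∈-subsets p))

∈-subsetPairs : (pq : Subset n × Subset n) → pq ∈ₗ cartesianProduct (subsets n) (subsets n)
∈-subsetPairs (p , q) = ∈-cartesianProduct⁺ (∈-subsets p) (∈-subsets q)

drop-disjoint : ∀ {s t} {p q : Subset n} → (∀ x → x ∈ t ∷ q → x ∉ s ∷ p) → ∀ x → x ∈ q → x ∉ p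
drop-disjoint disj x x∈q x∈p = disj (suc x) (there x∈q) (there x∈p)

p⊆q∧∣q∣≤∣p∣⇒p≡q : {p q : Subset n} → p ⊆ q → ∣ q ∣ ≤ ∣ p ∣ → p ≡ q
p⊆q∧∣q∣≤∣p∣⇒p≡q {p = []}          {[]}          _   _          = refl
p⊆q∧∣q∣≤∣p∣⇒p≡q {p = inside ∷ p}  {inside ∷ q}  p⊆q (s≤s q≤p) =
  cong (inside ∷_) (p⊆q∧∣q∣≤∣p∣⇒p≡q (drop-∷-⊆ p⊆q) q≤p)
p⊆q∧∣q∣≤∣p∣⇒p≡q {p = outside ∷ p} {outside ∷ q} p⊆q q≤p       =
  cong (outside ∷_) (p⊆q∧∣q∣≤∣p∣⇒p≡q (drop-∷-⊆ p⊆q) q≤p)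
p⊆q∧∣q∣≤∣p∣⇒p≡q {p = inside ∷ p}  {outside ∷ q} p⊆q _         with () ← p⊆q here
p⊆q∧∣q∣≤∣p∣⇒p≡q {p = outside ∷ p} {inside ∷ q}  p⊆q q≤p       =
  ⊥-elim (1+n≰n (≤-trans q≤p (p⊆q⇒∣p∣≤∣q∣ (drop-∷-⊆ p⊆q))))

∣p∪q∣≡∣p∣+∣q∣ : (p q : Subset n) → (∀ x → x ∈ q → x ∉ p) → ∣ p ∪ q ∣ ≡ ∣ p ∣ + ∣ q ∣
∣p∪q∣≡∣p∣+∣q∣ []            []            _    = refl
∣p∪q∣≡∣p∣+∣q∣ (inside ∷ p)  (inside ∷ q)  disj = ⊥-elim (disj zero here here)
∣p∪q∣≡∣p∣+∣q∣ (inside ∷ p)  (outside ∷ q) disj = cong suc (∣p∪q∣≡∣p∣+∣q∣ p q (drop-disjoint disj))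
∣p∪q∣≡∣p∣+∣q∣ (outside ∷ p) (inside ∷ q)  disj =
  trans (cong suc (∣p∪q∣≡∣p∣+∣q∣ p q (drop-disjoint disj))) (≡.sym (+-suc ∣ p ∣ ∣ q ∣))
∣p∪q∣≡∣p∣+∣q∣ (outside ∷ p) (outside ∷ q) disj = ∣p∪q∣≡∣p∣+∣q∣ p q (drop-disjoint disj)

∣p∣+∣∁p∣≡n : (p : Subset n) → ∣ p ∣ + ∣ ∁ p ∣ ≡ n
∣p∣+∣∁p∣≡n p = trans (cong (∣ p ∣ +_) (∣∁p∣≡n∸∣p∣ p)) (m+[n∸m]≡n (∣p∣≤n p))

∣p∣≤∣q∣⇒∣∁q∣≤∣∁p∣ : (p q : Subset n) → ∣ p ∣ ≤ ∣ q ∣ → ∣ ∁ q ∣ ≤ ∣ ∁ p ∣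
∣p∣≤∣q∣⇒∣∁q∣≤∣∁p∣ {n} p q p≤q rewrite ∣∁p∣≡n∸∣p∣ p | ∣∁p∣≡n∸∣p∣ q = ∸-monoʳ-≤ n p≤q

∣p∩q∣+∣p∩∁q∣≡∣p∣ : (p q : Subset n) → ∣ p ∩ q ∣ + ∣ p ∩ ∁ q ∣ ≡ ∣ p ∣
∣p∩q∣+∣p∩∁q∣≡∣p∣ []            []            = refl
∣p∩q∣+∣p∩∁q∣≡∣p∣ (inside ∷ p)  (inside ∷ q)  = cong suc (∣p∩q∣+∣p∩∁q∣≡∣p∣ p q)
∣p∩q∣+∣p∩∁q∣≡∣p∣ (inside ∷ p)  (outside ∷ q) = trans (+-suc _ _) (cong suc (∣p∩q∣+∣p∩∁q∣≡∣p∣ p q))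
∣p∩q∣+∣p∩∁q∣≡∣p∣ (outside ∷ p) (_ ∷ q)       = ∣p∩q∣+∣p∩∁q∣≡∣p∣ p q

∣p∣+∣r∣≤∣q∣+∣r∩∁q∣ : (p q r : Subset n) → p ⊆ q → (∀ x → x ∈ r → x ∉ p) →
  ∣ p ∣ + ∣ r ∣ ≤ ∣ q ∣ + ∣ r ∩ ∁ q ∣
∣p∣+∣r∣≤∣q∣+∣r∩∁q∣ p q r p⊆q disj = begin
  ∣ p ∣ + ∣ r ∣                      ≡⟨ cong (∣ p ∣ +_) (∣p∩q∣+∣p∩∁q∣≡∣p∣ r q) ⟨
  ∣ p ∣ + (∣ r ∩ q ∣ + ∣ r ∩ ∁ q ∣)  ≡⟨ +-assoc ∣ p ∣ _ _ ⟨
  ∣ p ∣ + ∣ r ∩ q ∣ + ∣ r ∩ ∁ q ∣    ≡⟨ cong (_+ ∣ r ∩ ∁ q ∣) (∣p∪q∣≡∣p∣+∣q∣ p (r ∩ q) r∩q∩p≡∅) ⟨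
  ∣ p ∪ (r ∩ q) ∣ + ∣ r ∩ ∁ q ∣      ≤⟨ +-monoˡ-≤ ∣ r ∩ ∁ q ∣ (p⊆q⇒∣p∣≤∣q∣ p∪r∩q⊆q) ⟩
  ∣ q ∣ + ∣ r ∩ ∁ q ∣                ∎
  where
  open ≤-Reasoning

  r∩q∩p≡∅ : ∀ x → x ∈ r ∩ q → x ∉ p
  r∩q∩p≡∅ x x∈r∩q = disj x (proj₁ (x∈p∩q⁻ r q x∈r∩q))

  p∪r∩q⊆q : p ∪ (r ∩ q) ⊆ q
  p∪r∩q⊆q x∈ with x∈p∪q⁻ p (r ∩ q) x∈
  ... | inj₁ x∈p   = p⊆q x∈p
  ... | inj₂ x∈r∩q = proj₂ (x∈p∩q⁻ r q x∈r∩q)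

injectiveOn⇒∣p∣≤∣q∣ : (f : Fin n → Fin k) (p : Subset n) (q : Subset k) →
  (∀ u v → u ∈ p → v ∈ p → f u ≡ f v → u ≡ v) → (∀ v → v ∈ p → f v ∈ q) → ∣ p ∣ ≤ ∣ q ∣
injectiveOn⇒∣p∣≤∣q∣ f []            q _   _    = z≤n
injectiveOn⇒∣p∣≤∣q∣ f (outside ∷ p) q inj into =
  injectiveOn⇒∣p∣≤∣q∣ (f ∘ suc) p q
    (λ u v u∈p v∈p eq → suc-injective (inj (suc u) (suc v) (there u∈p) (there v∈p) eq))
    (λ v v∈p → into (suc v) (there v∈p))
injectiveOn⇒∣p∣≤∣q∣ f (inside ∷ p)  q inj into =
  ≤-trans (s≤s (injectiveOn⇒∣p∣≤∣q∣ (f ∘ suc) p (q - f zero)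
    (λ u v u∈p v∈p eq → suc-injective (inj (suc u) (suc v) (there u∈p) (there v∈p) eq))
    (λ v v∈p → x∈p∧x≢y⇒x∈p-y (into (suc v) (there v∈p))
                 (λ eq → 0≢1+n (inj zero (suc v) here (there v∈p) (≡.sym eq))))))
  (x∈p⇒∣p-x∣<∣p∣ (into zero here))

rank : (p : Subset n) (v : Fin n) → v ∈ p → Fin ∣ p ∣
rank (inside ∷ p)  zero    _           = zero
rank (inside ∷ p)  (suc v) (there v∈p) = suc (rank p v v∈p)
rank (outside ∷ p) (suc v) (there v∈p) = rank p v v∈p

rank-injective : (p : Subset n) (u v : Fin n) (u∈p : u ∈ p) (v∈p : v ∈ p) →
  rank p u u∈p ≡ rank p v v∈p → u ≡ v
rank-injective (inside ∷ p)  zero    zero    _           _           _  = refl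
rank-injective (inside ∷ p)  zero    (suc v) _           (there _)   ()
rank-injective (inside ∷ p)  (suc u) zero    (there _)   _           ()
rank-injective (inside ∷ p)  (suc u) (suc v) (there u∈p) (there v∈p) eq =
  cong suc (rank-injective p u v u∈p v∈p (suc-injective eq))
rank-injective (outside ∷ p) (suc u) (suc v) (there u∈p) (there v∈p) eq =
  cong suc (rank-injective p u v u∈p v∈p eq)

fibre : (Fin n → Fin k) → Fin k → Subset n
fibre c j = tabulate (λ v → does (c v ≟ᶠ j))

∈-fibre⁺ : (c : Fin n → Fin k) {j : Fin k} {v : Fin n} → c v ≡ j → v ∈ fibre c j
∈-fibre⁺ c {j} {v} cv≡j = lookup⇒[]= v _ (trans (lookup∘tabulate _ v) (dec-true (c v ≟ᶠ j) cv≡j))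

∈-fibre⁻ : (c : Fin n → Fin k) {j : Fin k} {v : Fin n} → v ∈ fibre c j → c v ≡ j
∈-fibre⁻ c {j} {v} v∈
  with c v ≟ᶠ j | trans (≡.sym (lookup∘tabulate (λ v → does (c v ≟ᶠ j)) v)) ([]=⇒lookup v∈)
... | yes cv≡j | _ = cv≡j
... | no _     | ()

module _ (G : Graph n) where

  Walk⇒≡ : ∀ {u v} → Walk G u v 0 → u ≡ v
  Walk⇒≡ nil = refl

  Walk⇒Adj : ∀ {u v} → Walk G u v 1 → Adj G u v
  Walk⇒Adj (cons uv nil) = uv

  Walk⇒firstEdge : ∀ {u v k} → Walk G u v (suc k) → ∃ (Adj G u)
  Walk⇒firstEdge (cons uw _) = _ , uw

  Adj⇒≢ : ∀ {u v} → Adj G u v → u ≢ v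
  Adj⇒≢ uv refl = irrefl G uv

  Adj⇒Dist : ∀ {u v} → Adj G u v → Dist G u v 1
  Adj⇒Dist uv = cons uv nil , λ { zero _ uu → Adj⇒≢ uv (Walk⇒≡ uu) ; (suc _) (s≤s ()) _ }

  Dist-functional : ∀ {u v j k} → Dist G u v j → Dist G u v k → j ≡ k
  Dist-functional {j = j} {k} (walkʲ , shortestʲ) (walkᵏ , shortestᵏ) with <-cmp j k
  ... | tri< j<k _ _ = ⊥-elim (shortestᵏ j j<k walkʲ)
  ... | tri≈ _ j≡k _ = j≡k
  ... | tri> _ _ k<j = ⊥-elim (shortestʲ k k<j walkᵏ)

  nonadjacent⇒2≤Dist : ∀ {u v} k → u ≢ v → ¬ Adj G u v → Dist G u v k → 2 ≤ k
  nonadjacent⇒2≤Dist zero          u≢v _   (uv , _) = ⊥-elim (u≢v (Walk⇒≡ uv))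
  nonadjacent⇒2≤Dist (suc zero)    _   ¬uv (uv , _) = ⊥-elim (¬uv (Walk⇒Adj uv))
  nonadjacent⇒2≤Dist (suc (suc k)) _   _   _        = s≤s (s≤s z≤n)

  Diam⇒connected : ∀ {δ} → Diam G δ → ∀ u v → ∃ (Dist G u v)
  Diam⇒connected (within , _) u v with k , uvᵏ , _ ← within u v = k , uvᵏ

  Diam⇒Adj : ∀ {δ} → Diam G (suc δ) → ∃ λ u → ∃ (Adj G u)
  Diam⇒Adj (_ , u , _ , walk , _) = u , Walk⇒firstEdge walk

  module Decidability (connected : ∀ u v → ∃ (Dist G u v)) where

    dist? : ∀ u v k → Dec (Dist G u v k)
    dist? u v k with j , uvʲ ← connected u v with j ≟ k
    ... | yes refl = yes uvʲ
    ... | no j≢k   = no (λ uvᵏ → j≢k (Dist-functional uvʲ uvᵏ))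

    adj? : ∀ u v → Dec (Adj G u v)
    adj? u v with dist? u v 1
    ... | yes (uv , _) = yes (Walk⇒Adj uv)
    ... | no ¬uv       = no (¬uv ∘ Adj⇒Dist)

    independent? : Decidable (Independent G)
    independent? I = all? λ u → all? λ v → (u ∈? I) →-dec ((v ∈? I) →-dec ¬? (adj? u v))

    isCliqueDminus? : ∀ δ A → Decidable (IsCliqueDminus G δ A)
    isCliqueDminus? δ A K =
      (all? λ v → (v ∈? K) →-dec ¬? (v ∈? A)) ×-dec
      (all? λ u → all? λ v → (u ∈? K) →-dec ((v ∈? K) →-dec (¬? (u ≟ᶠ v) →-dec dist? u v δ)))

IsCliqueDminus-∩∁ : ∀ {G : Graph n} {δ I K} A → IsCliqueDminus G δ I K → IsCliqueDminus G δ A (K ∩ ∁ A)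
IsCliqueDminus-∩∁ {K = K} A (_ , clique) =
  (λ v v∈ → x∈∁p⇒x∉p (proj₂ (x∈p∩q⁻ K (∁ A) v∈))) ,
  (λ u v u∈ v∈ → clique u v (proj₁ (x∈p∩q⁻ K (∁ A) u∈)) (proj₁ (x∈p∩q⁻ K (∁ A) v∈)))

Admissible : Graph n → ℕ → Subset n × Subset n → Set
Admissible G δ (I , K) = Independent G I × IsCliqueDminus G δ I K

size : Subset n × Subset n → ℕ
size (I , K) = ∣ I ∣ + ∣ K ∣

admissible⇒∣I∪K∣≡size : ∀ {G : Graph n} {δ I K} → Admissible G δ (I , K) → ∣ I ∪ K ∣ ≡ size (I , K)
admissible⇒∣I∪K∣≡size {I = I} {K} (_ , (K∩I≡∅ , _)) = ∣p∪q∣≡∣p∣+∣q∣ I K K∩I≡∅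

admissible⇒∣∁I∪K∣+size≡n : ∀ {G : Graph n} {δ I K} → Admissible G δ (I , K) →
  ∣ ∁ (I ∪ K) ∣ + size (I , K) ≡ n
admissible⇒∣∁I∪K∣+size≡n {n} {I = I} {K} admissible = begin
  ∣ ∁ (I ∪ K) ∣ + size (I , K)  ≡⟨ cong (∣ ∁ (I ∪ K) ∣ +_) (admissible⇒∣I∪K∣≡size admissible) ⟨
  ∣ ∁ (I ∪ K) ∣ + ∣ I ∪ K ∣     ≡⟨ +-comm ∣ ∁ (I ∪ K) ∣ _ ⟩
  ∣ I ∪ K ∣ + ∣ ∁ (I ∪ K) ∣     ≡⟨ ∣p∣+∣∁p∣≡n (I ∪ K) ⟩
  n                            ∎
  where open ≡.≡-Reasoning

IsMaximum⇒∣∁I∪K∣-minimal : ∀ {G : Graph n} {δ I K J L} → IsMaximum (Admissible G δ) size (I , K) →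
  Admissible G δ (J , L) → ∣ ∁ (I ∪ K) ∣ ≤ ∣ ∁ (J ∪ L) ∣
IsMaximum⇒∣∁I∪K∣-minimal {I = I} {K} {J} {L} (admissibleIK , optimal) admissibleJL =
  ∣p∣≤∣q∣⇒∣∁q∣≤∣∁p∣ (J ∪ L) (I ∪ K)
    (subst₂ _≤_ (≡.sym (admissible⇒∣I∪K∣≡size admissibleJL))
                (≡.sym (admissible⇒∣I∪K∣≡size admissibleIK))
                (optimal (J , L) admissibleJL))

module _ (G : Graph n) (connected : ∀ u v → ∃ (Dist G u v)) (δ : ℕ) where
  open Decidability G connected

  maximalIndependent-extension : ∀ {I} → Independent G I → ∃ λ A → I ⊆ A × MaximalIndependent G A
  maximalIndependent-extension {I} indI
    with A , (I⊆A , indA) , largest ←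
           maximum-exists (λ A → (I ⊆? A) ×-dec independent? A) ∣_∣ ∈-subsets (⊆-refl , indI)
    = A , I⊆A , indA , λ B A⊆B indB → p⊆q∧∣q∣≤∣p∣⇒p≡q A⊆B (largest B ((A⊆B ∘ I⊆A) , indB))

  maximum-admissible : ∃ (IsMaximum (Admissible G δ) size)
  maximum-admissible = maximum-exists admissible? size ∈-subsetPairs {⊥ , ⊥} empty
    where
    admissible? : Decidable (Admissible G δ)
    admissible? (I , K) = independent? I ×-dec isCliqueDminus? δ I K

    empty : Admissible G δ (⊥ , ⊥)
    empty = (λ _ _ u∈⊥ _ _ → ∉⊥ u∈⊥) , (λ _ v∈⊥ _ → ∉⊥ v∈⊥) , (λ _ _ u∈⊥ _ _ → ⊥-elim (∉⊥ u∈⊥))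

  IsMaximum⇒IsMPrime : ∀ {I K} → IsMaximum (Admissible G δ) size (I , K) → IsMPrime G δ (size (I , K))
  IsMaximum⇒IsMPrime {I} {K} ((indI , cliqueK) , optimal)
    with A , I⊆A , maxA ← maximalIndependent-extension indI
    with Kω , cliqueKω , largestKω ←
           maximum-exists (isCliqueDminus? δ A) ∣_∣ ∈-subsets (IsCliqueDminus-∩∁ A cliqueK)
    = (A , maxA , ∣ Kω ∣ , ((Kω , cliqueKω , refl) , largestKω) , size≡) , bounded
    where
    size≡ : ∣ A ∣ + ∣ Kω ∣ ≡ size (I , K)
    size≡ = ≤-antisym (optimal (A , Kω) (proj₁ maxA , cliqueKω))
      (≤-trans (∣p∣+∣r∣≤∣q∣+∣r∩∁q∣ I A K I⊆A (proj₁ cliqueK))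
               (+-monoʳ-≤ ∣ A ∣ (largestKω (K ∩ ∁ A) (IsCliqueDminus-∩∁ A cliqueK))))

    bounded : ∀ A′ → MaximalIndependent G A′ → ∀ w → IsCliqueNumberDminus G δ A′ w →
      ∣ A′ ∣ + w ≤ size (I , K)
    bounded A′ (indA′ , _) w ((K′ , cliqueK′ , refl) , _) = optimal (A′ , K′) (indA′ , cliqueK′)

module PairColouring (G : Graph n) {δ : ℕ} (2<δ : 2 < δ) {I K : Subset n} (admissible : Admissible G δ (I , K)) where

  X : Subset n
  X = ∁ (I ∪ K)

  ∉I∪K⇒∈X : ∀ {v} → v ∉ I → v ∉ K → v ∈ X
  ∉I∪K⇒∈X v∉I v∉K = x∉p⇒x∈∁p λ v∈I∪K → [ v∉I , v∉K ]′ (x∈p∪q⁻ I K v∈I∪K)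

  colour : Fin n → Fin (2 + ∣ X ∣)
  colour v with v ∈? I | v ∈? K
  ... | yes _   | _       = zero
  ... | no _    | yes _   = suc zero
  ... | no v∉I  | no v∉K  = suc (suc (rank X v (∉I∪K⇒∈X v∉I v∉K)))

  colour≡0⇒∈I : ∀ v → colour v ≡ zero → v ∈ I
  colour≡0⇒∈I v eq with v ∈? I | v ∈? K | eq
  ... | yes v∈I | _     | _  = v∈I
  ... | no _    | yes _ | ()
  ... | no _    | no _  | ()

  colour≡1⇒∈K : ∀ v → colour v ≡ suc zero → v ∈ K
  colour≡1⇒∈K v eq with v ∈? I | v ∈? K | eq
  ... | yes _ | _       | ()
  ... | no _  | yes v∈K | _  = v∈K
  ... | no _  | no _    | ()

  colour≡2+⇒rank : ∀ v {j} → colour v ≡ suc (suc j) → Σ (v ∈ X) λ v∈X → rank X v v∈X ≡ j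
  colour≡2+⇒rank v eq with v ∈? I | v ∈? K | eq
  ... | yes _ | _     | ()
  ... | no _  | yes _ | ()
  ... | no _  | no _  | refl = _ , refl

  isPacking : IsPackingColoring G (2 + ∣ X ∣) colour
  isPacking u v u≢v cu≡cv = sameColour (colour u) refl (≡.sym cu≡cv)
    where
    sameColour : ∀ j → colour u ≡ j → colour v ≡ j → ∀ d → Dist G u v d → suc (toℕ j) < d
    sameColour zero          cu cv d uvᵈ =
      nonadjacent⇒2≤Dist G d u≢v (proj₁ admissible u v (colour≡0⇒∈I u cu) (colour≡0⇒∈I v cv)) uvᵈ
    sameColour (suc zero)    cu cv d uvᵈ =
      subst (2 <_) (Dist-functional G (proj₂ (proj₂ admissible) u v (colour≡1⇒∈K u cu) (colour≡1⇒∈K v cv) u≢v) uvᵈ)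
        2<δ
    sameColour (suc (suc j)) cu cv d uvᵈ
      with u∈X , ranku ← colour≡2+⇒rank u cu
      with v∈X , rankv ← colour≡2+⇒rank v cv
      = ⊥-elim (u≢v (rank-injective X u v u∈X v∈X (trans ranku (≡.sym rankv))))

admissible⇒packingColorable : {G : Graph n} {δ : ℕ} → 2 < δ → ∀ {I K} → Admissible G δ (I , K) →
  PackingColorable G (2 + ∣ ∁ (I ∪ K) ∣)
admissible⇒packingColorable 2<δ admissible = colour , isPacking
  where open PairColouring _ 2<δ admissible

Adj⇒2≤colours : ∀ {G : Graph n} {u v} → Adj G u v → (c : Fin n → Fin k) → IsPackingColoring G k c → 2 ≤ k
Adj⇒2≤colours {k = zero}        {u = u} _ c _ with () ← c u
Adj⇒2≤colours {k = suc zero}    {G = G} {u} {v} uv c packing with c u | c v | packing u v (Adj⇒≢ G uv)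
... | zero | zero | packed with s≤s () ← packed refl 1 (Adj⇒Dist G uv)
Adj⇒2≤colours {k = suc (suc k)} _ _ _ = s≤s (s≤s z≤n)

indices≥2 : Subset (2 + k)
indices≥2 = outside ∷ outside ∷ ⊤

∈indices≥2⇒2≤toℕ : ∀ {j : Fin (2 + k)} → j ∈ indices≥2 → 2 ≤ toℕ j
∈indices≥2⇒2≤toℕ {j = suc (suc _)} _         = s≤s (s≤s z≤n)
∈indices≥2⇒2≤toℕ {j = suc zero}    (there ())

module ColourClasses (G : Graph n) (diam : Diam G 3) {k : ℕ}
  (c : Fin n → Fin (2 + k)) (packing : IsPackingColoring G (2 + k) c) where

  C₀ C₁ X : Subset n
  C₀ = fibre c zero
  C₁ = fibre c (suc zero)
  X  = ∁ (C₀ ∪ C₁)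

  d : Fin n → Fin n → ℕ
  d u v = proj₁ (proj₁ diam u v)

  uvᵈ : ∀ u v → Dist G u v (d u v)
  uvᵈ u v = proj₁ (proj₂ (proj₁ diam u v))

  d≤3 : ∀ u v → d u v ≤ 3
  d≤3 u v = proj₂ (proj₂ (proj₁ diam u v))

  independent : Independent G C₀
  independent u v u∈ v∈ uv with s≤s () ←
    subst (λ j → suc (toℕ j) < 1) (∈-fibre⁻ c u∈)
      (packing u v (Adj⇒≢ G uv) (trans (∈-fibre⁻ c u∈) (≡.sym (∈-fibre⁻ c v∈))) 1 (Adj⇒Dist G uv))

  disjoint : ∀ v → v ∈ C₁ → v ∉ C₀
  disjoint v v∈C₁ v∈C₀ = 0≢1+n (trans (≡.sym (∈-fibre⁻ c v∈C₀)) (∈-fibre⁻ c v∈C₁))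

  clique : ∀ u v → u ∈ C₁ → v ∈ C₁ → u ≢ v → Dist G u v 3
  clique u v u∈ v∈ u≢v = subst (Dist G u v) (≤-antisym (d≤3 u v) 3≤d) (uvᵈ u v)
    where
    3≤d : 3 ≤ d u v
    3≤d = subst (λ j → suc (toℕ j) < d u v) (∈-fibre⁻ c u∈)
            (packing u v u≢v (trans (∈-fibre⁻ c u∈) (≡.sym (∈-fibre⁻ c v∈))) (d u v) (uvᵈ u v))

  admissible : Admissible G 3 (C₀ , C₁)
  admissible = independent , disjoint , clique

  X→indices≥2 : ∀ v → v ∈ X → c v ∈ indices≥2
  X→indices≥2 v v∈X with c v in cv
  ... | zero        = ⊥-elim (x∈∁p⇒x∉p v∈X (x∈p∪q⁺ (inj₁ (∈-fibre⁺ c cv))))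
  ... | suc zero    = ⊥-elim (x∈∁p⇒x∉p v∈X (x∈p∪q⁺ (inj₂ (∈-fibre⁺ c cv))))
  ... | suc (suc _) = there (there ∈⊤)

  -- A colour of index ≥ 2 is a colour ≥ 3, which would need distance > 3 = diam G.
  injectiveOnX : ∀ u v → u ∈ X → v ∈ X → c u ≡ c v → u ≡ v
  injectiveOnX u v u∈X v∈X cu≡cv with u ≟ᶠ v
  ... | yes u≡v = u≡v
  ... | no u≢v  = ⊥-elim (≤⇒≯ (d≤3 u v)
         (≤-trans (s≤s (s≤s (∈indices≥2⇒2≤toℕ (X→indices≥2 u u∈X))))
                  (packing u v u≢v cu≡cv (d u v) (uvᵈ u v))))

  ∣X∣≤k : ∣ X ∣ ≤ k
  ∣X∣≤k = subst (∣ X ∣ ≤_) (∣⊤∣≡n k) (injectiveOn⇒∣p∣≤∣q∣ c X indices≥2 injectiveOnX X→indices≥2)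

packing⇒admissible : {G : Graph n} → Diam G 3 → (c : Fin n → Fin k) → IsPackingColoring G k c →
  Σ (Subset n × Subset n) λ (I , K) → Admissible G 3 (I , K) × 2 + ∣ ∁ (I ∪ K) ∣ ≤ k
packing⇒admissible {k = zero} {G} diam c packing
  with () ← Adj⇒2≤colours (proj₂ (proj₂ (Diam⇒Adj G diam))) c packing
packing⇒admissible {k = suc zero} {G} diam c packing
  with s≤s () ← Adj⇒2≤colours (proj₂ (proj₂ (Diam⇒Adj G diam))) c packing
packing⇒admissible {k = suc (suc k)} {G} diam c packing = (C₀ , C₁) , admissible , s≤s (s≤s ∣X∣≤k)
  where open ColourClasses G diam c packing

theorem16 : (n : ℕ) (G : Graph n) → Diam G 3 →
    Σ ℕ λ m → Σ ℕ λ χ →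
      IsMPrime G 3 m × IsPackingChromaticNumber G χ × χ + m ≡ n + 2
theorem16 n G diam with (I , K) , maximum ← maximum-admissible G (Diam⇒connected G diam) 3 =
  size (I , K) , 2 + ∣ ∁ (I ∪ K) ∣ ,
  IsMaximum⇒IsMPrime G (Diam⇒connected G diam) 3 maximum ,
  (admissible⇒packingColorable ≤-refl (proj₁ maximum) , minimal) ,
  trans (cong (2 +_) (admissible⇒∣∁I∪K∣+size≡n (proj₁ maximum))) (+-comm 2 n)
  where
  minimal : ∀ k → PackingColorable G k → 2 + ∣ ∁ (I ∪ K) ∣ ≤ k
  minimal k (c , packing) with (J , L) , admissibleJL , bound ← packing⇒admissible diam c packing =
    ≤-trans (+-monoʳ-≤ 2 (IsMaximum⇒∣∁I∪K∣-minimal maximum admissibleJL)) bound
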